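{- Let $d\ge 2$ and let $G$ be the $r_1\times r_2\times\dots\times r_d$ grid graph, and $G^{4,4}$ the $4r_1\times 4r_2\times r_3\times\dots\times r_d$ grid graph. Then $h_2^B(G)\le h_1^B(G^{4,4})$.
   Context: The $r_1\times\dots\times r_d$ grid graph has vertex set $\prod_{j=1}^d\{0,\dots,r_j-1\}$, two vertices adjacent iff their coordinate vectors differ in exactly one coordinate and there by exactly $1$; its distinguished vertex is $s=(0,\dots,0)$. Search problem: $G=(V,E)$ is a finite simple undirected graph with a distinguished vertex $s$. An unknown simple directed graph $D$ on $V$ is given whose arcs, ignoring orientation, are edges of $G$, in which every vertex has outdegree at most $1$ and $s$ has indegree $0$. Let $t$ be the end vertex of the directed path in $D$ starting at $s$. Setting 1: every vertex other than $s$ has indegree exactly $1$ in $D$. Setting 2: $D$ is a directed path starting at $s$ (vertices not on it have in- and outdegree $0$). Query B: one asks a vertex $v$; the answer is the set of (at most two) arcs of $D$ incident to $v$, with their directions. $h_i^B(G)$ is the minimum, over adaptive strategies, of the worst-case number of type B queries needed to determine $t$ in Setting $i$. -}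

module Defs where

open import Data.Nat using (ℕ; zero; suc; _*_; _≤_; _<_; ∣_-_∣; s≤s; z≤n)
open import Data.Nat.Properties using (*-monoʳ-<)
open import Data.Fin using (Fin; toℕ; fromℕ<)
open import Data.Vec using (Vec; []; _∷_)
open import Data.List.Relation.Unary.All using () renaming (All to AllL)
open import Data.Vec.Relation.Unary.All using (All; []; _∷_)
open import Data.Maybe using (Maybe; just; nothing)
open import Data.Product using (Σ; _×_; _,_; proj₁; proj₂; ∃)
open import Data.Sum using (_⊎_)
open import Data.Unit using (⊤; tt)
open import Relation.Binary.PropositionalEquality using (_≡_; _≢_)

record Graph : Set₁ where
  field
    V : Set
    E : V → V → Set
    s : V
open Graph public

GridV : ∀ {d} → Vec ℕ d → Set
GridV []       = ⊤
GridV (r ∷ rs) = Fin r × GridV rs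

GridAdj : ∀ {d} (rs : Vec ℕ d) → GridV rs → GridV rs → Set
GridAdj []       _       _       = Data.Empty.⊥
  where import Data.Empty
GridAdj (r ∷ rs) (x , u) (y , w) =
  (∣ toℕ x - toℕ y ∣ ≡ 1 × u ≡ w) ⊎ (x ≡ y × GridAdj rs u w)

origin : ∀ {d} (rs : Vec ℕ d) → All (0 <_) rs → GridV rs
origin []       []         = tt
origin (r ∷ rs) (p ∷ ps)   = fromℕ< p , origin rs ps

gridGraph : ∀ {d} (rs : Vec ℕ d) → All (0 <_) rs → Graph
gridGraph rs ps = record { V = GridV rs ; E = GridAdj rs ; s = origin rs ps }

sizes44 : ∀ {m} → ℕ → ℕ → Vec ℕ m → Vec ℕ (suc (suc m))
sizes44 r₁ r₂ rs = 4 * r₁ ∷ 4 * r₂ ∷ rs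

pos44 : ∀ {m} (r₁ r₂ : ℕ) (rs : Vec ℕ m) →
        All (0 <_) (r₁ ∷ r₂ ∷ rs) → All (0 <_) (sizes44 r₁ r₂ rs)
pos44 r₁ r₂ rs (p₁ ∷ p₂ ∷ ps) = *-monoʳ-< 4 p₁ ∷ *-monoʳ-< 4 p₂ ∷ ps

-- The hidden digraph D (outdegree ≤ 1; in both settings indegree ≤ 1,
-- so D is represented by its successor and predecessor maps)

record Digraph (G : Graph) : Set where
  field
    next : V G → Maybe (V G)
    prev : V G → Maybe (V G)
    next⇒prev : ∀ v w → next v ≡ just w → prev w ≡ just v
    prev⇒next : ∀ v w → prev w ≡ just v → next v ≡ just w
    arcsInG   : ∀ v w → next v ≡ just w → E G v w
    sIndeg0   : prev (s G) ≡ nothing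
open Digraph public

data OnPath {G : Graph} (D : Digraph G) : V G → Set where
  start : OnPath D (s G)
  step  : ∀ {v w} → OnPath D v → next D v ≡ just w → OnPath D w

IsEnd : {G : Graph} → Digraph G → V G → Set
IsEnd D t = OnPath D t × next D t ≡ nothing

data SettingNo : Set where
  one two : SettingNo

Setting : SettingNo → (G : Graph) → Digraph G → Set
Setting one G D = ∀ v → v ≢ s G → ∃ λ u → prev D v ≡ just u
Setting two G D = ∀ v → OnPath D v ⊎ (prev D v ≡ nothing × next D v ≡ nothing)

-- answer to a type-B query at v: (tail of arc into v, head of arc out of v)
AnswerB : Graph → Set
AnswerB G = Maybe (V G) × Maybe (V G)

data Strategy (G : Graph) : Set where
  output : V G → Strategy G
  query  : V G → (AnswerB G → Strategy G) → Strategy G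

answerB : {G : Graph} → Digraph G → V G → AnswerB G
answerB D v = prev D v , next D v

run : {G : Graph} → Digraph G → Strategy G → V G × ℕ
run D (output v)  = v , 0
run D (query v k) with run D (k (answerB D v))
... | (t , n) = t , suc n

Solves : SettingNo → (G : Graph) → Strategy G → ℕ → Set
Solves i G S k = ∀ (D : Digraph G) → Setting i G D → ∀ t → IsEnd D t →
                 proj₁ (run D S) ≡ t × proj₂ (run D S) ≤ k

hB≤ : SettingNo → Graph → ℕ → Set
hB≤ i G k = Σ (Strategy G) λ S → Solves i G S k

module Submission where

open import Defs
open import Data.Nat using (ℕ; _<_)
open import Data.Vec using (Vec; []; _∷_)
open import Data.Vec.Relation.Unary.All using (All; []; _∷_)

open import Data.Bool using (Bool; true; false; not; if_then_else_; _∨_; _xor_; T)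
open import Data.Bool.Properties using (T?; not-distribˡ-xor; not-distribʳ-xor; not-involutive)
open import Data.Empty using (⊥-elim)
open import Data.Fin using (Fin; toℕ; fromℕ<; #_; cast; combine; remQuot)
open import Data.Fin.Properties
  using (all?; toℕ-injective; toℕ-fromℕ<; cast-involutive; toℕ-cast; toℕ-combine; remQuot-combine; combine-remQuot)
  renaming (_≟_ to _≟F_)
open import Data.List using (List; []; _∷_; _++_)
open import Data.List.NonEmpty using (List⁺; _∷_; toList; reverse; head; last)
open import Data.Maybe using (Maybe; just; nothing; maybe; is-just) renaming (map to mapM)
open import Data.Nat using (zero; suc; _+_; _*_; _≤_; ∣_-_∣)
open import Data.Nat.Properties using (∣-∣-comm; *-comm; *-monoʳ-<; ∣m+n-m+o∣≡∣n-o∣) renaming (_≟_ to _≟ℕ_)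
open import Data.Nat.Tactic.RingSolver using (solve-∀)
open import Data.Product using (Σ-syntax; ∃; _×_; _,_; proj₁; proj₂)
open import Data.Product.Properties using (≡-dec)
open import Data.Sum using (_⊎_; inj₁; inj₂)
open import Relation.Nullary using (Dec; yes; no; ¬_; does; contradiction)
open import Relation.Nullary.Decidable using (_×-dec_; _⊎-dec_; _→-dec_; ¬?; map′; from-yes; dec-true; dec-false)
open import Relation.Binary.PropositionalEquality using (_≡_; refl; _≢_; sym; trans; cong; cong₂; subst)

-- Each vertex v of G is blown up into the 4 × 4 block of H made of the cells
-- (4a + i, 4b + j, z) for v = (a, b, z).  An instance D of Setting 2 on G (a
-- path from s, all other vertices isolated) becomes an instance D' of Setting 1
-- on H: the block of a vertex of the path is traversed by a Hamiltonian path from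
-- the port facing its predecessor to the port facing its successor, and the block
-- of an isolated vertex is covered by a Hamiltonian cycle, so every vertex of H
-- except the corner of the block of s gets a predecessor.  The gadget of a block
-- depends only on the type-B answer at v (and on the colour of v in the remaining
-- coordinates, which lets the ports match across steps in those coordinates), so
-- every query of a strategy for H is answered by one query on G, and the end of
-- the path of D' lies in the block of the end of the path of D.

record Reduction (i j : SettingNo) (G H : Graph) : Set where
  field
    over         : V H → V G
    local        : V H → AnswerB G → AnswerB H
    lift         : Digraph G → Digraph H
    lift-local   : ∀ D w → answerB (lift D) w ≡ local w (answerB D (over w))
    lift-setting : ∀ D → Setting i G D → Setting j H (lift D)
    lift-end     : ∀ D → Setting i G D → ∀ t → IsEnd D t →
                   Σ[ t' ∈ V H ] IsEnd (lift D) t' × over t' ≡ t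

module _ {i j G H} (R : Reduction i j G H) where
  open Reduction R

  translate : Strategy H → Strategy G
  translate (output w)  = output (over w)
  translate (query w k) = query (over w) (λ a → translate (k (local w a)))

  run-translate : ∀ D S → run D (translate S) ≡ (over (proj₁ (run (lift D) S)) , proj₂ (run (lift D) S))
  run-translate D (output w)  = refl
  run-translate D (query w k)
    rewrite lift-local D w | run-translate D (k (local w (answerB D (over w)))) = refl

  reduce : ∀ k → hB≤ j H k → hB≤ i G k
  reduce k (S , solves) = translate S , λ D setting t end →
    let (t' , end' , over-t') = lift-end D setting t end
        (output≡t' , cost≤k)  = solves (lift D) (lift-setting D setting) t' end'
    in subst (λ r → proj₁ r ≡ t × proj₂ r ≤ k) (sym (run-translate D S))
             (trans (cong over output≡t') over-t' , cost≤k)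

-- Arithmetic of grids.

distance-one : ∀ m n → ∣ m - n ∣ ≡ 1 → n ≡ suc m ⊎ m ≡ suc n
distance-one zero          (suc zero) _ = inj₁ refl
distance-one (suc zero)    zero       _ = inj₂ refl
distance-one (suc m)       (suc n)    d with distance-one m n d
... | inj₁ e = inj₁ (cong suc e)
... | inj₂ e = inj₂ (cong suc e)

distance-suc : ∀ m → ∣ m - suc m ∣ ≡ 1
distance-suc zero    = refl
distance-suc (suc m) = distance-suc m

-- the interval {0,…,4r-1} as r consecutive blocks of 4: place a i = 4a + i
place : ∀ {r} → Fin r → Fin 4 → Fin (4 * r)
place {r} a i = cast (*-comm r 4) (combine a i)

unplace : ∀ {r} → Fin (4 * r) → Fin r × Fin 4
unplace {r} x = remQuot 4 (cast (*-comm 4 r) x)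

unplace-place : ∀ {r} (a : Fin r) i → unplace (place a i) ≡ (a , i)
unplace-place {r} a i =
  trans (cong (remQuot 4) (cast-involutive (*-comm 4 r) (*-comm r 4) (combine a i)))
        (remQuot-combine a i)

place-unplace : ∀ {r} (x : Fin (4 * r)) → place (proj₁ (unplace {r} x)) (proj₂ (unplace {r} x)) ≡ x
place-unplace {r} x =
  trans (cong (cast (*-comm r 4)) (combine-remQuot {r} 4 (cast (*-comm 4 r) x)))
        (cast-involutive (*-comm r 4) (*-comm 4 r) x)

toℕ-place : ∀ {r} (a : Fin r) i → toℕ (place a i) ≡ 4 * toℕ a + toℕ i
toℕ-place {r} a i = trans (toℕ-cast (*-comm r 4) (combine a i)) (toℕ-combine a i)

place-zero : ∀ {r} (p : 0 < r) (q : 0 < 4 * r) → fromℕ< q ≡ place (fromℕ< p) (# 0)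
place-zero p q = toℕ-injective (trans (toℕ-fromℕ< q)
                   (sym (trans (toℕ-place (fromℕ< p) (# 0)) (cong (λ n → 4 * n + 0) (toℕ-fromℕ< p)))))

place-distance : ∀ {r} (a : Fin r) i j → ∣ toℕ (place a i) - toℕ (place a j) ∣ ≡ ∣ toℕ i - toℕ j ∣
place-distance a i j rewrite toℕ-place a i | toℕ-place a j = ∣m+n-m+o∣≡∣n-o∣ (4 * toℕ a) (toℕ i) (toℕ j)

next-block : ∀ n → 4 * suc n + 0 ≡ suc (4 * n + 3)
next-block = solve-∀

block-boundary : ∀ {r} (a a' : Fin r) → toℕ a' ≡ suc (toℕ a) →
                 ∣ toℕ (place a (# 3)) - toℕ (place a' (# 0)) ∣ ≡ 1
block-boundary a a' e rewrite toℕ-place a (# 3) | toℕ-place a' (# 0) | e | next-block (toℕ a) =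
  distance-suc (4 * toℕ a + 3)

block-boundary⁻ : ∀ {r} (a a' : Fin r) → toℕ a ≡ suc (toℕ a') →
                  ∣ toℕ (place a (# 0)) - toℕ (place a' (# 3)) ∣ ≡ 1
block-boundary⁻ a a' e = trans (∣-∣-comm (toℕ (place a (# 0))) (toℕ (place a' (# 3)))) (block-boundary a' a e)

adjacent-sym : ∀ {d} (rs : Vec ℕ d) g g' → GridAdj rs g g' → GridAdj rs g' g
adjacent-sym (r ∷ rs) (x , g) (x' , .g) (inj₁ (d , refl)) = inj₁ (trans (∣-∣-comm (toℕ x') (toℕ x)) d , refl)
adjacent-sym (r ∷ rs) (x , g) (.x , g') (inj₂ (refl , a)) = inj₂ (refl , adjacent-sym rs g g' a)

odd : ℕ → Bool
odd zero    = false
odd (suc n) = not (odd n)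

parity : ∀ {d} (rs : Vec ℕ d) → GridV rs → Bool
parity []       _       = false
parity (r ∷ rs) (x , g) = odd (toℕ x) xor parity rs g

parity-adjacent : ∀ {d} (rs : Vec ℕ d) g g' → GridAdj rs g g' → parity rs g' ≡ not (parity rs g)
parity-adjacent (r ∷ rs) (x , g) (x' , .g) (inj₁ (d , refl)) with distance-one (toℕ x) (toℕ x') d
... | inj₁ e rewrite e = sym (not-distribˡ-xor (odd (toℕ x)) (parity rs g))
... | inj₂ e rewrite e = trans (sym (not-involutive _)) (cong not (not-distribˡ-xor (odd (toℕ x')) (parity rs g)))
parity-adjacent (r ∷ rs) (x , g) (.x , g') (inj₂ (refl , a)) rewrite parity-adjacent rs g g' a =
  sym (not-distribʳ-xor (odd (toℕ x)) (parity rs g))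

parity-origin : ∀ {d} (rs : Vec ℕ d) ps → parity rs (origin rs ps) ≡ false
parity-origin []       []       = refl
parity-origin (r ∷ rs) (p ∷ ps) rewrite toℕ-fromℕ< p = parity-origin rs ps

_≟V_ : ∀ {d} {rs : Vec ℕ d} (g g' : GridV rs) → Dec (g ≡ g')
_≟V_ {rs = []}     _ _ = yes refl
_≟V_ {rs = r ∷ rs} = ≡-dec _≟F_ _≟V_

data Move : Set where
  up down stay : Move

move : ℕ → ℕ → Move
move n n' = if does (n' ≟ℕ suc n) then up else if does (n ≟ℕ suc n') then down else stay

move-up : ∀ {n n'} → n' ≡ suc n → move n n' ≡ up
move-up {n} {n'} e rewrite dec-true (n' ≟ℕ suc n) e = refl

no-two-cycle : ∀ {n n'} → n ≡ suc n' → ¬ n' ≡ suc n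
no-two-cycle refl ()

move-down : ∀ {n n'} → n ≡ suc n' → move n n' ≡ down
move-down {n} {n'} e rewrite dec-false (n' ≟ℕ suc n) (no-two-cycle e) | dec-true (n ≟ℕ suc n') e = refl

move-stay : ∀ n → move n n ≡ stay
move-stay n rewrite dec-false (n ≟ℕ suc n) (λ ()) = refl

-- The 4 × 4 gadgets.  A block is a grid of 16 cells (i, j); it is left or
-- entered through ports, boundary cells that face the neighbouring block.

Cell : Set
Cell = Fin 4 × Fin 4

c00 c01 c02 c03 c10 c11 c12 c13 c20 c21 c22 c23 c30 c31 c32 c33 : Cell
c00 = # 0 , # 0
c01 = # 0 , # 1
c02 = # 0 , # 2
c03 = # 0 , # 3
c10 = # 1 , # 0
c11 = # 1 , # 1
c12 = # 1 , # 2
c13 = # 1 , # 3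
c20 = # 2 , # 0
c21 = # 2 , # 1
c22 = # 2 , # 2
c23 = # 2 , # 3
c30 = # 3 , # 0
c31 = # 3 , # 1
c32 = # 3 , # 2
c33 = # 3 , # 3

_≟C_ : (c d : Cell) → Dec (c ≡ d)
_≟C_ = ≡-dec _≟F_ _≟F_

CellAdj : Cell → Cell → Set
CellAdj (i , j) (i' , j') = (∣ toℕ i - toℕ i' ∣ ≡ 1 × j ≡ j') ⊎ (i ≡ i' × ∣ toℕ j - toℕ j' ∣ ≡ 1)

cellAdj? : ∀ c d → Dec (CellAdj c d)
cellAdj? (i , j) (i' , j') =
  ((∣ toℕ i - toℕ i' ∣ ≟ℕ 1) ×-dec (j ≟F j')) ⊎-dec ((i ≟F i') ×-dec (∣ toℕ j - toℕ j' ∣ ≟ℕ 1))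

-- directions of a step in G: along the first two coordinates, or (oo) along another one
data Dir : Set where
  xp xm yp ym oo : Dir

flip : Dir → Dir
flip xp = xm
flip xm = xp
flip yp = ym
flip ym = yp
flip oo = oo

shift : Dir → Bool → Bool
shift oo p = not p
shift _  p = p

-- the ports: three cells of even colour and four of odd colour
data EvenPort : Set where
  e00 e31 e13 : EvenPort

data OddPort : Set where
  o30 o01 o03 o10 : OddPort

evenCell : EvenPort → Cell
evenCell e00 = c00
evenCell e31 = c31
evenCell e13 = c13

oddCell : OddPort → Cell
oddCell o30 = c30
oddCell o01 = c01
oddCell o03 = c03
oddCell o10 = c10

evenPort : Dir → EvenPort
evenPort xp = e31
evenPort yp = e13
evenPort _  = e00

oddPort : Dir → OddPort
oddPort xp = o30
oddPort xm = o01
oddPort yp = o03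
oddPort ym = o10
oddPort oo = o01

-- a block of colour p is left towards e through  port p e  and entered from
-- direction e through  port (not p) e ; the colours make these cells line up
port : Bool → Dir → Cell
port false e = oddCell (oddPort e)
port true  e = evenCell (evenPort e)

-- a Hamiltonian path of the block from each even port to each odd port
ham : EvenPort → OddPort → List⁺ Cell
ham e00 o30 = c00 ∷ c01 ∷ c02 ∷ c03 ∷ c13 ∷ c12 ∷ c11 ∷ c10 ∷ c20 ∷ c21 ∷ c22 ∷ c23 ∷ c33 ∷ c32 ∷ c31 ∷ c30 ∷ []
ham e00 o01 = c00 ∷ c10 ∷ c11 ∷ c12 ∷ c22 ∷ c21 ∷ c20 ∷ c30 ∷ c31 ∷ c32 ∷ c33 ∷ c23 ∷ c13 ∷ c03 ∷ c02 ∷ c01 ∷ []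
ham e00 o03 = c00 ∷ c01 ∷ c02 ∷ c12 ∷ c11 ∷ c10 ∷ c20 ∷ c30 ∷ c31 ∷ c21 ∷ c22 ∷ c32 ∷ c33 ∷ c23 ∷ c13 ∷ c03 ∷ []
ham e00 o10 = c00 ∷ c01 ∷ c02 ∷ c03 ∷ c13 ∷ c12 ∷ c11 ∷ c21 ∷ c22 ∷ c23 ∷ c33 ∷ c32 ∷ c31 ∷ c30 ∷ c20 ∷ c10 ∷ []
ham e31 o30 = c31 ∷ c21 ∷ c11 ∷ c12 ∷ c22 ∷ c32 ∷ c33 ∷ c23 ∷ c13 ∷ c03 ∷ c02 ∷ c01 ∷ c00 ∷ c10 ∷ c20 ∷ c30 ∷ []
ham e31 o01 = c31 ∷ c30 ∷ c20 ∷ c21 ∷ c22 ∷ c32 ∷ c33 ∷ c23 ∷ c13 ∷ c03 ∷ c02 ∷ c12 ∷ c11 ∷ c10 ∷ c00 ∷ c01 ∷ []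
ham e31 o03 = c31 ∷ c30 ∷ c20 ∷ c10 ∷ c00 ∷ c01 ∷ c02 ∷ c12 ∷ c11 ∷ c21 ∷ c22 ∷ c32 ∷ c33 ∷ c23 ∷ c13 ∷ c03 ∷ []
ham e31 o10 = c31 ∷ c30 ∷ c20 ∷ c21 ∷ c11 ∷ c12 ∷ c22 ∷ c32 ∷ c33 ∷ c23 ∷ c13 ∷ c03 ∷ c02 ∷ c01 ∷ c00 ∷ c10 ∷ []
ham e13 o30 = c13 ∷ c03 ∷ c02 ∷ c01 ∷ c00 ∷ c10 ∷ c11 ∷ c12 ∷ c22 ∷ c23 ∷ c33 ∷ c32 ∷ c31 ∷ c21 ∷ c20 ∷ c30 ∷ []
ham e13 o01 = c13 ∷ c03 ∷ c02 ∷ c12 ∷ c11 ∷ c21 ∷ c22 ∷ c23 ∷ c33 ∷ c32 ∷ c31 ∷ c30 ∷ c20 ∷ c10 ∷ c00 ∷ c01 ∷ []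
ham e13 o03 = c13 ∷ c12 ∷ c11 ∷ c21 ∷ c22 ∷ c23 ∷ c33 ∷ c32 ∷ c31 ∷ c30 ∷ c20 ∷ c10 ∷ c00 ∷ c01 ∷ c02 ∷ c03 ∷ []
ham e13 o10 = c13 ∷ c03 ∷ c02 ∷ c12 ∷ c22 ∷ c23 ∷ c33 ∷ c32 ∷ c31 ∷ c30 ∷ c20 ∷ c21 ∷ c11 ∷ c01 ∷ c00 ∷ c10 ∷ []

cycle : List⁺ Cell
cycle = c00 ∷ c10 ∷ c20 ∷ c30 ∷ c31 ∷ c32 ∷ c33 ∷ c23 ∷ c13 ∷ c03 ∷ c02 ∷ c12 ∷ c22 ∷ c21 ∷ c11 ∷ c01 ∷ []

-- the route through a block of colour p entered from i and left towards o
-- (a missing port is replaced by c00 or c01)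
routeCells : Bool → Maybe Dir → Maybe Dir → List⁺ Cell
routeCells false i o = ham (maybe evenPort e00 i) (maybe oddPort o01 o)
routeCells true  i o = reverse (ham (maybe evenPort e00 o) (maybe oddPort o01 i))

-- how a vertex of G is reached: it is s, it has no predecessor, or it is
-- entered from direction e
data Role : Set where
  source idle : Role
  entered     : Dir → Role

-- a route whose entry and exit ports are open or closed, or a cycle
data Gadget : Set where
  route : Bool → List⁺ Cell → Bool → Gadget
  tour  : List⁺ Cell → Gadget

gadget : Bool → Role → Maybe Dir → Gadget
gadget p idle        nothing = tour cycle
gadget p (entered e) o       = route true (routeCells p (just e) o) (is-just o)
gadget p r           o       = route false (routeCells p nothing o) (is-just o)

data Link : Set where
  inside  : Cell → Link
  viaPort : Link
  none    : Link

after : Bool → List Cell → Cell → Link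
after portOpen []       c = none
after portOpen (x ∷ xs) c = if does (x ≟C c) then onward xs else after portOpen xs c
  where
    onward : List Cell → Link
    onward []      = if portOpen then viaPort else none
    onward (y ∷ _) = inside y

closeUp : List⁺ Cell → List Cell
closeUp (x ∷ xs) = x ∷ xs ++ x ∷ []

nextL : Gadget → Cell → Link
nextL (route _ cs out) = after out (toList cs)
nextL (tour cs)        = after false (closeUp cs)

prevL : Gadget → Cell → Link
prevL (route inn cs _) = after inn (toList (reverse cs))
prevL (tour cs)        = after false (closeUp (reverse cs))

first final : Gadget → Cell
first (route _ cs _) = head cs
first (tour cs)      = head cs
final (route _ cs _) = last cs
final (tour cs)      = head cs

mutual
  reaches : Gadget → ℕ → Cell → Cell → Bool
  reaches g n c t = does (c ≟C t) ∨ continue g n (nextL g c) t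

  continue : Gadget → ℕ → Link → Cell → Bool
  continue g (suc n) (inside c') t = reaches g n c' t
  continue g _       _           t = false

reaches-sound : ∀ g (Q : Cell → Set) → (∀ {c c'} → nextL g c ≡ inside c' → Q c → Q c') →
                ∀ n c t → T (reaches g n c t) → Q c → Q t
reaches-sound g Q advance n c t r q with c ≟C t
... | yes refl = q
... | no _ with nextL g c in eq | n
...   | inside c' | suc m = reaches-sound g Q advance m c' t r (advance eq q)

data Linked : Link → Set where
  inside  : ∀ c → Linked (inside c)
  viaPort : Linked viaPort

data Internal : Link → Set where
  inside : ∀ c → Internal (inside c)

-- The facts about gadgets used below quantify over
-- finitely many colours, roles, directions and cells; each is established by
-- evaluating a decision procedure built from the following combinators.

Searchable : Set → Set₁
Searchable A = {P : A → Set} → (∀ x → Dec (P x)) → Dec (∀ x → P x)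

search-Bool : Searchable Bool
search-Bool P? = map′ (λ (f , t) → λ { false → f ; true → t }) (λ h → h false , h true)
                      (P? false ×-dec P? true)

search-Dir : Searchable Dir
search-Dir P? = map′ (λ (a , b , c , d , e) → λ { xp → a ; xm → b ; yp → c ; ym → d ; oo → e })
                     (λ h → h xp , h xm , h yp , h ym , h oo)
                     (P? xp ×-dec P? xm ×-dec P? yp ×-dec P? ym ×-dec P? oo)

search-Maybe : ∀ {A} → Searchable A → Searchable (Maybe A)
search-Maybe search P? = map′ (λ (n , j) → λ { nothing → n ; (just x) → j x })
                               (λ h → h nothing , λ x → h (just x))
                               (P? nothing ×-dec search (λ x → P? (just x)))

search-Out : Searchable (Maybe Dir)
search-Out = search-Maybe search-Dir

search-Role : Searchable Role
search-Role P? = map′ (λ (s , i , e) → λ { source → s ; idle → i ; (entered d) → e d })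
                      (λ h → h source , h idle , λ d → h (entered d))
                      (P? source ×-dec P? idle ×-dec search-Dir (λ d → P? (entered d)))

search-Cell : Searchable Cell
search-Cell P? = map′ (λ h (i , j) → h i j) (λ h i j → h (i , j))
                      (all? λ i → all? λ j → P? (i , j))

search-Config : {P : Bool → Role → Maybe Dir → Set} → (∀ p r o → Dec (P p r o)) → Dec (∀ p r o → P p r o)
search-Config P? = search-Bool λ p → search-Role λ r → search-Out λ o → P? p r o

whenInside? : {P : Cell → Set} (l : Link) → (∀ c → Dec (P c)) → Dec (∀ c → l ≡ inside c → P c)
whenInside? (inside c) P? = map′ (λ p → λ { _ refl → p }) (λ h → h c refl) (P? c)
whenInside? viaPort    P? = yes λ _ ()
whenInside? none       P? = yes λ _ ()

_≟L_ : (l m : Link) → Dec (l ≡ m)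
inside c ≟L inside d = map′ (λ { refl → refl }) (λ { refl → refl }) (c ≟C d)
inside _ ≟L viaPort  = no λ ()
inside _ ≟L none     = no λ ()
viaPort  ≟L inside _ = no λ ()
viaPort  ≟L viaPort  = yes refl
viaPort  ≟L none     = no λ ()
none     ≟L inside _ = no λ ()
none     ≟L viaPort  = no λ ()
none     ≟L none     = yes refl

idle? : ∀ r → Dec (r ≡ idle)
idle? source      = no λ ()
idle? idle        = yes refl
idle? (entered _) = no λ ()

linked? : ∀ l → Dec (Linked l)
linked? (inside c) = yes (inside c)
linked? viaPort    = yes viaPort
linked? none       = no λ ()

internal? : ∀ l → Dec (Internal l)
internal? (inside c) = yes (inside c)
internal? viaPort    = no λ ()
internal? none       = no λ ()

next-inside : ∀ p r o c c' → nextL (gadget p r o) c ≡ inside c' →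
              prevL (gadget p r o) c' ≡ inside c × CellAdj c c'
next-inside = from-yes (search-Config λ p r o → search-Cell λ c →
  whenInside? (nextL (gadget p r o) c) λ c' → (prevL (gadget p r o) c' ≟L inside c) ×-dec cellAdj? c c')

prev-inside : ∀ p r o c c' → prevL (gadget p r o) c ≡ inside c' → nextL (gadget p r o) c' ≡ inside c
prev-inside = from-yes (search-Config λ p r o → search-Cell λ c →
  whenInside? (prevL (gadget p r o) c) λ c' → nextL (gadget p r o) c' ≟L inside c)

leaves-at-exit : ∀ p r e c → nextL (gadget p r (just e)) c ≡ viaPort → c ≡ port p e
leaves-at-exit = from-yes (search-Bool λ p → search-Role λ r → search-Dir λ e → search-Cell λ c →
  (nextL (gadget p r (just e)) c ≟L viaPort) →-dec (c ≟C port p e))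

exit-open : ∀ p r e → nextL (gadget p r (just e)) (port p e) ≡ viaPort
exit-open = from-yes (search-Bool λ p → search-Role λ r → search-Dir λ e →
  nextL (gadget p r (just e)) (port p e) ≟L viaPort)

enters-at-entry : ∀ p e o c → prevL (gadget p (entered e) o) c ≡ viaPort → c ≡ port (not p) e
enters-at-entry = from-yes (search-Bool λ p → search-Dir λ e → search-Out λ o → search-Cell λ c →
  (prevL (gadget p (entered e) o) c ≟L viaPort) →-dec (c ≟C port (not p) e))

entry-open : ∀ p e o → prevL (gadget p (entered e) o) (port (not p) e) ≡ viaPort
entry-open = from-yes (search-Bool λ p → search-Dir λ e → search-Out λ o →
  prevL (gadget p (entered e) o) (port (not p) e) ≟L viaPort)

entered-covered : ∀ p e o c → Linked (prevL (gadget p (entered e) o) c)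
entered-covered = from-yes (search-Bool λ p → search-Dir λ e → search-Out λ o → search-Cell λ c →
  linked? (prevL (gadget p (entered e) o) c))

source-covered : ∀ o c → c ≢ c00 → Internal (prevL (gadget false source o) c)
source-covered = from-yes (search-Out λ o → search-Cell λ c →
  ¬? (c ≟C c00) →-dec internal? (prevL (gadget false source o) c))

source-corner : ∀ o → prevL (gadget false source o) c00 ≡ none
source-corner = from-yes (search-Out λ o → prevL (gadget false source o) c00 ≟L none)

idle-covered : ∀ p c → Internal (prevL (gadget p idle nothing) c)
idle-covered = from-yes (search-Bool λ p → search-Cell λ c → internal? (prevL (gadget p idle nothing) c))

traversable : ∀ p r o → T (reaches (gadget p r o) 15 (first (gadget p r o)) (final (gadget p r o)))
traversable = from-yes (search-Config λ p r o →
  T? (reaches (gadget p r o) 15 (first (gadget p r o)) (final (gadget p r o))))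

first-entered : ∀ p e o → first (gadget p (entered e) o) ≡ port (not p) e
first-entered = from-yes (search-Bool λ p → search-Dir λ e → search-Out λ o →
  first (gadget p (entered e) o) ≟C port (not p) e)

first-source : ∀ o → first (gadget false source o) ≡ c00
first-source = from-yes (search-Out λ o → first (gadget false source o) ≟C c00)

final-exit : ∀ p r e → final (gadget p r (just e)) ≡ port p e
final-exit = from-yes (search-Bool λ p → search-Role λ r → search-Dir λ e →
  final (gadget p r (just e)) ≟C port p e)

final-closed : ∀ p r → r ≢ idle → nextL (gadget p r nothing) (final (gadget p r nothing)) ≡ none
final-closed = from-yes (search-Bool λ p → search-Role λ r →
  ¬? (idle? r) →-dec (nextL (gadget p r nothing) (final (gadget p r nothing)) ≟L none))

module BlowUp {m} (r₁ r₂ : ℕ) (rs : Vec ℕ m) (p₁ : 0 < r₁) (p₂ : 0 < r₂) (ps : All (0 <_) rs) where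

  G H : Graph
  G = gridGraph (r₁ ∷ r₂ ∷ rs) (p₁ ∷ p₂ ∷ ps)
  H = gridGraph (sizes44 r₁ r₂ rs) (pos44 r₁ r₂ rs (p₁ ∷ p₂ ∷ ps))

  VG VH : Set
  VG = V G
  VH = V H

  AdjG : VG → VG → Set
  AdjG = E G

  AdjH : VH → VH → Set
  AdjH = E H

  sG : VG
  sG = s G

  _⊗_ : VG → Cell → VH
  (a , b , z) ⊗ (i , j) = place a i , place b j , z

  block : VH → VG
  block (x , y , z) = proj₁ (unplace {r₁} x) , proj₁ (unplace {r₂} y) , z

  cell : VH → Cell
  cell (x , y , z) = proj₂ (unplace {r₁} x) , proj₂ (unplace {r₂} y)

  block-cell-⊗ : ∀ v c → (block (v ⊗ c) , cell (v ⊗ c)) ≡ (v , c)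
  block-cell-⊗ (a , b , z) (i , j) =
    cong₂ (λ (a' , i') (b' , j') → (a' , b' , z) , (i' , j')) (unplace-place a i) (unplace-place b j)

  ⊗-block-cell : ∀ w → block w ⊗ cell w ≡ w
  ⊗-block-cell (x , y , z) = cong₂ (λ x' y' → x' , y' , z) (place-unplace {r₁} x) (place-unplace {r₂} y)

  by-blocks : {P : VH → Set} → (∀ v c → P (v ⊗ c)) → ∀ w → P w
  by-blocks {P} h w = subst P (⊗-block-cell w) (h (block w) (cell w))

  s-corner : s H ≡ sG ⊗ c00
  s-corner = cong₂ (λ x y → x , y , origin rs ps)
                   (place-zero p₁ (*-monoʳ-< 4 p₁)) (place-zero p₂ (*-monoʳ-< 4 p₂))

  colour : VG → Bool
  colour (_ , _ , z) = parity rs z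

  colour-s : colour sG ≡ false
  colour-s = parity-origin rs ps

  dirOf : Move → Move → Dir
  dirOf up   _    = xp
  dirOf down _    = xm
  dirOf stay up   = yp
  dirOf stay down = ym
  dirOf stay stay = oo

  -- the direction of the step from v to u (meaningful when they are adjacent)
  dir : VG → VG → Dir
  dir (a , b , _) (a' , b' , _) = dirOf (move (toℕ a) (toℕ a')) (move (toℕ b) (toℕ b'))

  Step : VG → VG → Dir → Set
  Step (a , b , z) (a' , b' , z') xp = toℕ a' ≡ suc (toℕ a) × b ≡ b' × z ≡ z'
  Step (a , b , z) (a' , b' , z') xm = toℕ a ≡ suc (toℕ a') × b ≡ b' × z ≡ z'
  Step (a , b , z) (a' , b' , z') yp = a ≡ a' × toℕ b' ≡ suc (toℕ b) × z ≡ z'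
  Step (a , b , z) (a' , b' , z') ym = a ≡ a' × toℕ b ≡ suc (toℕ b') × z ≡ z'
  Step (a , b , z) (a' , b' , z') oo = a ≡ a' × b ≡ b' × GridAdj rs z z'

  step-dir : ∀ v u e → Step v u e → dir v u ≡ e
  step-dir (a , b , z) (a' , b' , z') xp (e , _ , _)       rewrite move-up e = refl
  step-dir (a , b , z) (a' , b' , z') xm (e , _ , _)       rewrite move-down e = refl
  step-dir (a , b , z) (.a , b' , z') yp (refl , e , _)    rewrite move-stay (toℕ a) | move-up e = refl
  step-dir (a , b , z) (.a , b' , z') ym (refl , e , _)    rewrite move-stay (toℕ a) | move-down e = refl
  step-dir (a , b , z) (.a , .b , z') oo (refl , refl , _) rewrite move-stay (toℕ a) | move-stay (toℕ b) = refl

  step-flip : ∀ v u e → Step v u e → Step u v (flip e)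
  step-flip _ _ xp (e , b , z) = e , sym b , sym z
  step-flip _ _ xm (e , b , z) = e , sym b , sym z
  step-flip _ _ yp (a , e , z) = sym a , e , sym z
  step-flip _ _ ym (a , e , z) = sym a , e , sym z
  step-flip (_ , _ , z) (_ , _ , z') oo (a , b , g) = sym a , sym b , adjacent-sym rs z z' g

  step-colour : ∀ v u e → Step v u e → colour u ≡ shift e (colour v)
  step-colour _ _ xp (_ , _ , refl) = refl
  step-colour _ _ xm (_ , _ , refl) = refl
  step-colour _ _ yp (_ , _ , refl) = refl
  step-colour _ _ ym (_ , _ , refl) = refl
  step-colour (_ , _ , z) (_ , _ , z') oo (_ , _ , g) = parity-adjacent rs z z' g

  adjacent-step : ∀ v u → AdjG v u → ∃ (Step v u)
  adjacent-step (a , b , z) (a' , .b , .z) (inj₁ (d , refl)) with distance-one (toℕ a) (toℕ a') d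
  ... | inj₁ e = xp , e , refl , refl
  ... | inj₂ e = xm , e , refl , refl
  adjacent-step (a , b , z) (.a , b' , .z) (inj₂ (refl , inj₁ (d , refl))) with distance-one (toℕ b) (toℕ b') d
  ... | inj₁ e = yp , refl , e , refl
  ... | inj₂ e = ym , refl , e , refl
  adjacent-step (a , b , z) (.a , .b , z') (inj₂ (refl , inj₂ (refl , g))) = oo , refl , refl , g

  dir-step : ∀ v u → AdjG v u → Step v u (dir v u)
  dir-step v u adj = let (e , st) = adjacent-step v u adj in subst (Step v u) (sym (step-dir v u e st)) st

  dir-flip : ∀ v u → AdjG v u → dir u v ≡ flip (dir v u)
  dir-flip v u adj = step-dir u v _ (step-flip v u (dir v u) (dir-step v u adj))

  inside-adjacent : ∀ v c c' → CellAdj c c' → AdjH (v ⊗ c) (v ⊗ c')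
  inside-adjacent (a , b , z) (i , j) (i' , .j) (inj₁ (d , refl)) = inj₁ (trans (place-distance a i i') d , refl)
  inside-adjacent (a , b , z) (i , j) (.i , j') (inj₂ (refl , d)) =
    inj₂ (refl , inj₁ (trans (place-distance b j j') d , refl))

  ports-meet : ∀ v u p e → Step v u e → AdjH (v ⊗ port p e) (u ⊗ port (not (shift e p)) (flip e))
  ports-meet (a , b , z) (a' , .b , .z) false xp (e , refl , refl) = inj₁ (block-boundary a a' e , refl)
  ports-meet (a , b , z) (a' , .b , .z) true  xp (e , refl , refl) = inj₁ (block-boundary a a' e , refl)
  ports-meet (a , b , z) (a' , .b , .z) false xm (e , refl , refl) = inj₁ (block-boundary⁻ a a' e , refl)
  ports-meet (a , b , z) (a' , .b , .z) true  xm (e , refl , refl) = inj₁ (block-boundary⁻ a a' e , refl)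
  ports-meet (a , b , z) (.a , b' , .z) false yp (refl , e , refl) = inj₂ (refl , inj₁ (block-boundary b b' e , refl))
  ports-meet (a , b , z) (.a , b' , .z) true  yp (refl , e , refl) = inj₂ (refl , inj₁ (block-boundary b b' e , refl))
  ports-meet (a , b , z) (.a , b' , .z) false ym (refl , e , refl) = inj₂ (refl , inj₁ (block-boundary⁻ b b' e , refl))
  ports-meet (a , b , z) (.a , b' , .z) true  ym (refl , e , refl) = inj₂ (refl , inj₁ (block-boundary⁻ b b' e , refl))
  ports-meet (a , b , z) (.a , .b , z') false oo (refl , refl , g) = inj₂ (refl , inj₂ (refl , g))
  ports-meet (a , b , z) (.a , .b , z') true  oo (refl , refl , g) = inj₂ (refl , inj₂ (refl , g))

  exitPort entryPort : VG → VG → Cell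
  exitPort  v u = port (colour v) (dir v u)
  entryPort u v = port (not (colour u)) (dir u v)

  ports-adjacent : ∀ v u → AdjG v u → AdjH (v ⊗ exitPort v u) (u ⊗ entryPort u v)
  ports-adjacent v u adj rewrite dir-flip v u adj | step-colour v u (dir v u) (dir-step v u adj) =
    ports-meet v u (colour v) (dir v u) (dir-step v u adj)

  roleOf : VG → Maybe VG → Role
  roleOf v (just u) = entered (dir v u)
  roleOf v nothing  = if does (v ≟V sG) then source else idle

  role-source : roleOf sG nothing ≡ source
  role-source = cong (λ b → if b then source else idle) (dec-true (sG ≟V sG) refl)

  role-idle : ∀ {v} → v ≢ sG → roleOf v nothing ≡ idle
  role-idle {v} v≢s = cong (λ b → if b then source else idle) (dec-false (v ≟V sG) v≢s)

  gadgetAt : VG → AnswerB G → Gadget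
  gadgetAt v (pm , nm) = gadget (colour v) (roleOf v pm) (mapM (dir v) nm)

  forward : VG → Maybe VG → Link → Maybe VH
  forward v _        (inside c) = just (v ⊗ c)
  forward v (just u) viaPort    = just (u ⊗ entryPort u v)
  forward v _        _          = nothing

  backward : VG → Maybe VG → Link → Maybe VH
  backward v _        (inside c) = just (v ⊗ c)
  backward v (just u) viaPort    = just (u ⊗ exitPort u v)
  backward v _        _          = nothing

  localAt : VG → Cell → AnswerB G → AnswerB H
  localAt v c a = backward v (proj₁ a) (prevL (gadgetAt v a) c) , forward v (proj₂ a) (nextL (gadgetAt v a) c)

  local : VH → AnswerB G → AnswerB H
  local w = localAt (block w) (cell w)

  forward-port : ∀ {v nm w'} → forward v nm viaPort ≡ just w' → ∃ λ u → nm ≡ just u × w' ≡ u ⊗ entryPort u v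
  forward-port {nm = just u} refl = u , refl , refl

  backward-port : ∀ {v pm w} → backward v pm viaPort ≡ just w → ∃ λ u → pm ≡ just u × w ≡ u ⊗ exitPort u v
  backward-port {pm = just u} refl = u , refl , refl

  backward-linked : ∀ {v u l} → Linked l → ∃ λ w → backward v (just u) l ≡ just w
  backward-linked (inside c) = _ , refl
  backward-linked viaPort    = _ , refl

  backward-internal : ∀ {v pm l} → Internal l → ∃ λ w → backward v pm l ≡ just w
  backward-internal (inside c) = _ , refl

  module Lift (D : Digraph G) where

    roleAt : VG → Role
    roleAt v = roleOf v (prev D v)

    outAt : VG → Maybe Dir
    outAt v = mapM (dir v) (next D v)

    gadgetOf : VG → Gadget
    gadgetOf v = gadgetAt v (answerB D v)

    next' prev' : VH → Maybe VH
    next' w = proj₂ (local w (answerB D (block w)))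
    prev' w = proj₁ (local w (answerB D (block w)))

    local-at : ∀ v c → local (v ⊗ c) (answerB D (block (v ⊗ c))) ≡ localAt v c (answerB D v)
    local-at v c = cong (λ (v' , c') → localAt v' c' (answerB D v')) (block-cell-⊗ v c)

    next-at : ∀ v c → next' (v ⊗ c) ≡ forward v (next D v) (nextL (gadgetOf v) c)
    next-at v c = cong proj₂ (local-at v c)

    prev-at : ∀ v c → prev' (v ⊗ c) ≡ backward v (prev D v) (prevL (gadgetOf v) c)
    prev-at v c = cong proj₁ (local-at v c)

    entered-gadget : ∀ {u v} → prev D u ≡ just v → gadgetOf u ≡ gadget (colour u) (entered (dir u v)) (outAt u)
    entered-gadget inn rewrite inn = refl

    exit-gadget : ∀ {v u} → next D v ≡ just u → gadgetOf v ≡ gadget (colour v) (roleAt v) (just (dir v u))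
    exit-gadget out rewrite out = refl

    end-gadget : ∀ {v} → next D v ≡ nothing → gadgetOf v ≡ gadget (colour v) (roleAt v) nothing
    end-gadget out rewrite out = refl

    source-gadget : gadgetOf sG ≡ gadget false source (outAt sG)
    source-gadget rewrite sIndeg0 D | colour-s = cong (λ r → gadget false r (outAt sG)) role-source

    idle-gadget : ∀ {v} → prev D v ≡ nothing → next D v ≡ nothing → v ≢ sG →
                  gadgetOf v ≡ gadget (colour v) idle nothing
    idle-gadget {v} inn out v≢s rewrite inn | out = cong (λ r → gadget (colour v) r nothing) (role-idle v≢s)

    leaves-at : ∀ {v u c} → next D v ≡ just u → nextL (gadgetOf v) c ≡ viaPort → c ≡ exitPort v u
    leaves-at {v} {u} {c} out link =
      leaves-at-exit (colour v) (roleAt v) (dir v u) c (subst (λ g → nextL g c ≡ viaPort) (exit-gadget out) link)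

    enters-at : ∀ {u v c} → prev D u ≡ just v → prevL (gadgetOf u) c ≡ viaPort → c ≡ entryPort u v
    enters-at {u} {v} {c} inn link =
      enters-at-entry (colour u) (dir u v) (outAt u) c (subst (λ g → prevL g c ≡ viaPort) (entered-gadget inn) link)

    handoff : ∀ v u → next D v ≡ just u → prev' (u ⊗ entryPort u v) ≡ just (v ⊗ exitPort v u)
    handoff v u out rewrite prev-at u (entryPort u v) | entered-gadget (next⇒prev D v u out)
      | entry-open (colour u) (dir u v) (outAt u) | next⇒prev D v u out = refl

    handback : ∀ v u → next D v ≡ just u → next' (v ⊗ exitPort v u) ≡ just (u ⊗ entryPort u v)
    handback v u out rewrite next-at v (exitPort v u) | exit-gadget out
      | exit-open (colour v) (roleAt v) (dir v u) | out = refl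

    next-prev : ∀ v c {w'} l → nextL (gadgetOf v) c ≡ l → forward v (next D v) l ≡ just w' → prev' w' ≡ just (v ⊗ c)
    next-prev v c (inside c') link refl =
      trans (prev-at v c') (cong (backward v (prev D v)) (proj₁ (next-inside (colour v) (roleAt v) (outAt v) c c' link)))
    next-prev v c viaPort link eq with forward-port eq
    ... | u , out , refl =
      subst (λ c' → prev' (u ⊗ entryPort u v) ≡ just (v ⊗ c')) (sym (leaves-at out link)) (handoff v u out)

    prev-next : ∀ u c {w} l → prevL (gadgetOf u) c ≡ l → backward u (prev D u) l ≡ just w → next' w ≡ just (u ⊗ c)
    prev-next u c (inside c') link refl =
      trans (next-at u c') (cong (forward u (next D u)) (prev-inside (colour u) (roleAt u) (outAt u) c c' link))
    prev-next u c viaPort link eq with backward-port eq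
    ... | v , inn , refl =
      subst (λ c' → next' (v ⊗ exitPort v u) ≡ just (u ⊗ c')) (sym (enters-at inn link))
            (handback v u (prev⇒next D v u inn))

    arc : ∀ v c {w'} l → nextL (gadgetOf v) c ≡ l → forward v (next D v) l ≡ just w' → AdjH (v ⊗ c) w'
    arc v c (inside c') link refl = inside-adjacent v c c' (proj₂ (next-inside (colour v) (roleAt v) (outAt v) c c' link))
    arc v c viaPort link eq with forward-port eq
    ... | u , out , refl =
      subst (λ c' → AdjH (v ⊗ c') (u ⊗ entryPort u v)) (sym (leaves-at out link)) (ports-adjacent v u (arcsInG D v u out))

    D' : Digraph H
    D' = record
      { next      = next'
      ; prev      = prev'
      ; next⇒prev = by-blocks λ v c w' eq → next-prev v c _ refl (trans (sym (next-at v c)) eq)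
      ; prev⇒next = λ w → by-blocks λ u c eq → prev-next u c _ refl (trans (sym (prev-at u c)) eq)
      ; arcsInG   = by-blocks λ v c w' eq → arc v c _ refl (trans (sym (next-at v c)) eq)
      ; sIndeg0   = subst (λ w → prev' w ≡ nothing) (sym s-corner)
                      (trans (prev-at sG c00) (cong₂ (backward sG) (sIndeg0 D)
                        (trans (cong (λ g → prevL g c00) source-gadget) (source-corner (outAt sG)))))
      }

    onPath-entered : ∀ {v} → OnPath D v → v ≢ sG → ∃ λ u → prev D v ≡ just u
    onPath-entered start                  v≢s = ⊥-elim (v≢s refl)
    onPath-entered (step {u} {v} _ out) _   = u , next⇒prev D u v out

    HasPred : VH → Set
    HasPred w = ∃ λ w' → prev' w ≡ just w'

    entered-has-pred : ∀ {v u} c → prev D v ≡ just u → HasPred (v ⊗ c)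
    entered-has-pred {v} {u} c inn rewrite prev-at v c | entered-gadget inn | inn =
      backward-linked (entered-covered (colour v) (dir v u) (outAt v) c)

    source-has-pred : ∀ c → c ≢ c00 → HasPred (sG ⊗ c)
    source-has-pred c c≢ rewrite prev-at sG c | source-gadget = backward-internal (source-covered (outAt sG) c c≢)

    idle-has-pred : ∀ {v} c → prev D v ≡ nothing → next D v ≡ nothing → v ≢ sG → HasPred (v ⊗ c)
    idle-has-pred {v} c inn out v≢s rewrite prev-at v c | idle-gadget inn out v≢s =
      backward-internal (idle-covered (colour v) c)

    covered : Setting two G D → Setting one H D'
    covered setting = by-blocks cover
      where
        cover : ∀ v c → v ⊗ c ≢ s H → HasPred (v ⊗ c)
        cover v c ne with prev D v in inn | v ≟V sG
        ... | just u  | _        = entered-has-pred c inn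
        ... | nothing | yes refl = source-has-pred c (λ c≡ → ne (trans (cong (sG ⊗_) c≡) (sym s-corner)))
        ... | nothing | no v≢s with setting v
        ...   | inj₁ onPath    = let (u , inn') = onPath-entered onPath v≢s in contradiction (trans (sym inn) inn') λ ()
        ...   | inj₂ (_ , out) = idle-has-pred c inn out v≢s

    traverse : ∀ v → OnPath D' (v ⊗ first (gadgetOf v)) → OnPath D' (v ⊗ final (gadgetOf v))
    traverse v = reaches-sound (gadgetOf v) (λ c → OnPath D' (v ⊗ c))
                   (λ {c} link on → step on (trans (next-at v c) (cong (forward v (next D v)) link)))
                   15 _ _ (traversable (colour v) (roleAt v) (outAt v))

    first-at : ∀ {u v} → prev D u ≡ just v → first (gadgetOf u) ≡ entryPort u v
    first-at {u} {v} inn = trans (cong first (entered-gadget inn)) (first-entered (colour u) (dir u v) (outAt u))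

    final-at : ∀ {v u} → next D v ≡ just u → final (gadgetOf v) ≡ exitPort v u
    final-at {v} {u} out = trans (cong final (exit-gadget out)) (final-exit (colour v) (roleAt v) (dir v u))

    lift-path : ∀ {v} → OnPath D v → OnPath D' (v ⊗ first (gadgetOf v))
    lift-path start = subst (OnPath D') (trans s-corner (cong (sG ⊗_) (sym first-s))) start
      where
        first-s : first (gadgetOf sG) ≡ c00
        first-s = trans (cong first source-gadget) (first-source (outAt sG))
    lift-path (step {v} {u} onv out) =
      subst (λ c → OnPath D' (u ⊗ c)) (sym (first-at (next⇒prev D v u out)))
        (step (subst (λ c → OnPath D' (v ⊗ c)) (final-at out) (traverse v (lift-path onv))) (handback v u out))

    onPath-active : ∀ {v} → OnPath D v → roleAt v ≢ idle
    onPath-active start rewrite sIndeg0 D | role-source = λ ()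
    onPath-active (step {u} {v} _ out) rewrite next⇒prev D u v out = λ ()

    lift-end : ∀ t → IsEnd D t → IsEnd D' (t ⊗ final (gadgetOf t))
    lift-end t (ont , out) =
      traverse t (lift-path ont) ,
      trans (next-at t _) (cong (forward t (next D t)) (trans (cong (λ g → nextL g (final g)) (end-gadget out))
                                                               (final-closed (colour t) (roleAt t) (onPath-active ont))))

  reduction : Reduction two one G H
  reduction = record
    { over         = block
    ; local        = local
    ; lift         = Lift.D'
    ; lift-local   = λ D w → refl
    ; lift-setting = Lift.covered
    ; lift-end     = λ D _ t end →
        t ⊗ final (Lift.gadgetOf D t) , Lift.lift-end D t end , cong proj₁ (block-cell-⊗ t _)
    }

theorem6 : ∀ {m} (r₁ r₂ : ℕ) (rs : Vec ℕ m) (pos : All (0 <_) (r₁ ∷ r₂ ∷ rs)) →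
    ∀ k → hB≤ one (gridGraph (sizes44 r₁ r₂ rs) (pos44 r₁ r₂ rs pos)) k →
          hB≤ two (gridGraph (r₁ ∷ r₂ ∷ rs) pos) k
theorem6 r₁ r₂ rs (p₁ ∷ p₂ ∷ ps) = reduce (BlowUp.reduction r₁ r₂ rs p₁ p₂ ps)
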